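{- Let $n,k\in\mathbb{N}$ with $n\ge3$, $k\ge2$, let $G=MC_n^k$, let $l\in\mathbb{N}$ and let $f,g$ be two opposite lazy $l$-tracks on $G$. Then there exists $i\in\mathbb{N}_l$ such that $p_2(f(i))=p_2(g(i))$, i.e. $f(i)$ and $g(i)$ lie in the same layer.
   Context: For $n\ge3$, $k\ge2$, the multilayered cycle $MC_n^k$ is the graph with vertex set $\{(i,j): i\in\mathbb{Z}_n,\ j\in\{1,\dots,k\}\}$ in which $(a,b)$ and $(c,d)$ are adjacent iff either $a=c$ and $|d-b|=1$, or $b=d$ and $a-c\equiv\pm1 \pmod n$. The layer of vertex $(i,j)$ is $p_2(i,j)=j$. Write $\mathbb{N}_l=\{1,\dots,l\}$. A lazy $l$-track on a graph $G$ is a surjective map $f:\mathbb{N}_l\to V(G)$ with $f(i)f(i+1)\in E(G)$ or $f(i)=f(i+1)$ for all $i\in\mathbb{N}_{l-1}$. Two lazy $l$-tracks $f,g$ are opposite if for every $i\in\mathbb{N}_{l-1}$: $f(i)f(i+1)\in E(G)$ if and only if $g(i)=g(i+1)$. -}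

module Defs where

open import Data.Nat using (ℕ; suc; _%_; NonZero)
open import Data.Fin using (Fin; toℕ)
open import Data.Product using (_×_; _,_; proj₁; proj₂; ∃)
open import Data.Sum using (_⊎_)
open import Relation.Binary.PropositionalEquality using (_≡_)
open import Function.Definitions using (Surjective)

-- Vertices of MC_n^k: (i , j) with i ∈ ℤ_n (as Fin n, the residues 0..n-1)
-- and layer j ∈ {1..k}, encoded as Fin k (layer j is stored as j-1).
Vertex : ℕ → ℕ → Set
Vertex n k = Fin n × Fin k

p₂ : ∀ {n k} → Vertex n k → Fin k
p₂ = proj₂

LayerAdj : ∀ {k} → Fin k → Fin k → Set
LayerAdj b d = toℕ d ≡ suc (toℕ b) ⊎ toℕ b ≡ suc (toℕ d)

CycAdj : ∀ n → .{{NonZero n}} → Fin n → Fin n → Set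
CycAdj n a c = toℕ a ≡ suc (toℕ c) % n ⊎ toℕ c ≡ suc (toℕ a) % n

Adj : ∀ n k → .{{NonZero n}} → Vertex n k → Vertex n k → Set
Adj n k (a , b) (c , d) = (a ≡ c × LayerAdj b d) ⊎ (b ≡ d × CycAdj n a c)

-- consecutive indices in ℕ_l (encoded as Fin l, position i ↦ i+1)
Consecutive : ∀ {l} → Fin l → Fin l → Set
Consecutive i j = toℕ j ≡ suc (toℕ i)

record LazyTrack (n k l : ℕ) .{{_ : NonZero n}} : Set where
  field
    f    : Fin l → Vertex n k
    surj : Surjective _≡_ _≡_ f
    step : ∀ i j → Consecutive i j → Adj n k (f i) (f j) ⊎ f i ≡ f j

Opposite : ∀ {n k l} .{{_ : NonZero n}} → LazyTrack n k l → LazyTrack n k l → Set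
Opposite {n} {k} F G = ∀ i j → Consecutive i j →
  (Adj n k (LazyTrack.f F i) (LazyTrack.f F j) → LazyTrack.f G i ≡ LazyTrack.f G j)
  × (LazyTrack.f G i ≡ LazyTrack.f G j → Adj n k (LazyTrack.f F i) (LazyTrack.f F j))

-- Follow the layers a i of f(i) and b i of g(i). Since the tracks are opposite, at every
-- step one of the two stays put while the other moves to a neighbour, whose layer differs
-- by at most one; hence a and b can never jump over each other. Both tracks are
-- surjective, so f visits the top layer at some x (where b x ≤ a x) and g at some y
-- (where a y ≤ b y), and a discrete intermediate value argument between x and y yields
-- an index where a and b agree.
module Submission where

open import Defs
open import Data.Nat using (ℕ; _≤_; NonZero)
open import Data.Fin using (Fin)
open import Data.Product using (∃)
open import Relation.Binary.PropositionalEquality using (_≡_)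

open import Data.Nat using (suc; _<_; _<?_; _≤′_; ≤′-refl; ≤′-step; s≤s)
open import Data.Nat.Properties
  using (≤-refl; ≤-trans; ≤-antisym; <⇒≤; <-trans; n≤1+n; n<1+n; ≤-total; ≤-<-trans; ≮⇒≥; m<n⇒m<1+n; m≤n⇒m≤1+n; ≤⇒≤′)
open import Data.Fin using (toℕ; fromℕ; fromℕ<) renaming (zero to fzero)
open import Data.Fin.Properties using (fromℕ<-toℕ; toℕ-fromℕ<; toℕ-fromℕ; toℕ-injective; toℕ<n; toℕ≤pred[n])
open import Data.Product using (_,_; _×_; proj₁; proj₂)
open import Data.Sum using (_⊎_; inj₁; inj₂)
open import Function using (_∘_)
open import Relation.Nullary using (yes; no; contradiction)
open import Relation.Binary.PropositionalEquality using (refl; sym; trans; cong; subst; subst₂)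

Near : ℕ → ℕ → Set
Near x y = y ≡ x ⊎ y ≡ suc x ⊎ x ≡ suc y

AlternatingStep : ℕ → ℕ → ℕ → ℕ → Set
AlternatingStep a a′ b b′ = (a′ ≡ a × Near b b′) ⊎ (b′ ≡ b × Near a a′)

AlternatingStep-sym : ∀ {a a′ b b′} → AlternatingStep a a′ b b′ → AlternatingStep b b′ a a′
AlternatingStep-sym (inj₁ step) = inj₂ step
AlternatingStep-sym (inj₂ step) = inj₁ step

AlternatingStep-<⇒≤ : ∀ {a a′ b b′} → a < b → AlternatingStep a a′ b b′ → a′ ≤ b′
AlternatingStep-<⇒≤ a<b       (inj₁ (refl , inj₁ refl))        = <⇒≤ a<b
AlternatingStep-<⇒≤ a<b       (inj₁ (refl , inj₂ (inj₁ refl))) = m≤n⇒m≤1+n (<⇒≤ a<b)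
AlternatingStep-<⇒≤ (s≤s a≤b) (inj₁ (refl , inj₂ (inj₂ refl))) = a≤b
AlternatingStep-<⇒≤ a<b       (inj₂ (refl , inj₁ refl))        = <⇒≤ a<b
AlternatingStep-<⇒≤ a<b       (inj₂ (refl , inj₂ (inj₁ refl))) = a<b
AlternatingStep-<⇒≤ a<b       (inj₂ (refl , inj₂ (inj₂ refl))) = ≤-trans (n≤1+n _) (<⇒≤ a<b)

-- Induction on i ≤′ j shrinks the interval from the right: if a is still below b at
-- j - 1, the step to j forces a j ≤ b j, so they meet at j.
alternating-meet : (a b : ℕ → ℕ) {i j : ℕ} → i ≤′ j →
  (∀ t → t < j → AlternatingStep (a t) (a (suc t)) (b t) (b (suc t))) →
  a i ≤ b i → b j ≤ a j → ∃ λ t → t ≤ j × a t ≡ b t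
alternating-meet a b ≤′-refl _ ai≤bi bi≤ai = _ , ≤-refl , ≤-antisym ai≤bi bi≤ai
alternating-meet a b {j = suc j} (≤′-step i≤j) steps ai≤bi bj≤aj with a j <? b j
... | yes a<b = suc j , ≤-refl , ≤-antisym (AlternatingStep-<⇒≤ a<b (steps j ≤-refl)) bj≤aj
... | no a≮b with alternating-meet a b i≤j (λ t t<j → steps t (m<n⇒m<1+n t<j)) ai≤bi (≮⇒≥ a≮b)
...   | t , t≤j , eq = t , m≤n⇒m≤1+n t≤j , eq

-- The value 0 beyond l is never used.
extend : ∀ {l} → (Fin l → ℕ) → ℕ → ℕ
extend {l} h t with t <? l
... | yes t<l = h (fromℕ< t<l)
... | no _    = 0

extend-fromℕ< : ∀ {l} (h : Fin l → ℕ) {t} (t<l : t < l) → extend h t ≡ h (fromℕ< t<l)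
extend-fromℕ< {l} h {t} t<l with t <? l
... | yes _   = refl
... | no t≮l = contradiction t<l t≮l

extend-toℕ : ∀ {l} (h : Fin l → ℕ) (i : Fin l) → extend h (toℕ i) ≡ h i
extend-toℕ h i = trans (extend-fromℕ< h (toℕ<n i)) (cong h (fromℕ<-toℕ i (toℕ<n i)))

AlternatingWalks : ∀ {l} → (Fin l → ℕ) → (Fin l → ℕ) → Set
AlternatingWalks a b = ∀ i j → Consecutive i j → AlternatingStep (a i) (a j) (b i) (b j)

AlternatingWalks-sym : ∀ {l} {a b : Fin l → ℕ} → AlternatingWalks a b → AlternatingWalks b a
AlternatingWalks-sym walks i j c = AlternatingStep-sym (walks i j c)

extend-alternates : ∀ {l} (a b : Fin l → ℕ) → AlternatingWalks a b → ∀ t → suc t < l →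
  AlternatingStep (extend a t) (extend a (suc t)) (extend b t) (extend b (suc t))
extend-alternates {l} a b walks t 1+t<l =
  subst₂ (λ a₀ b₀ → AlternatingStep a₀ (extend a (suc t)) b₀ (extend b (suc t)))
    (sym (extend-fromℕ< a t<l)) (sym (extend-fromℕ< b t<l))
    (subst₂ (λ a₁ b₁ → AlternatingStep (a (fromℕ< t<l)) a₁ (b (fromℕ< t<l)) b₁)
      (sym (extend-fromℕ< a 1+t<l)) (sym (extend-fromℕ< b 1+t<l))
      (walks _ _ (trans (toℕ-fromℕ< 1+t<l) (cong suc (sym (toℕ-fromℕ< t<l))))))
  where
  t<l : t < l
  t<l = <-trans (n<1+n t) 1+t<l

alternating-walks-meet-ordered : ∀ {l} (a b : Fin l → ℕ) → AlternatingWalks a b →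
  ∀ x y → toℕ x ≤ toℕ y → a x ≤ b x → b y ≤ a y → ∃ λ t → a t ≡ b t
alternating-walks-meet-ordered {l} a b walks x y x≤y ax≤bx by≤ay
  with alternating-meet (extend a) (extend b) (≤⇒≤′ x≤y)
         (λ t t<y → extend-alternates a b walks t (≤-<-trans t<y (toℕ<n y)))
         (subst₂ _≤_ (sym (extend-toℕ a x)) (sym (extend-toℕ b x)) ax≤bx)
         (subst₂ _≤_ (sym (extend-toℕ b y)) (sym (extend-toℕ a y)) by≤ay)
... | t , t≤y , eq = fromℕ< t<l ,
  trans (sym (extend-fromℕ< a t<l)) (trans eq (extend-fromℕ< b t<l))
  where
  t<l : t < l
  t<l = ≤-<-trans t≤y (toℕ<n y)

alternating-walks-meet : ∀ {l} (a b : Fin l → ℕ) → AlternatingWalks a b →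
  ∀ x y → b x ≤ a x → a y ≤ b y → ∃ λ t → a t ≡ b t
alternating-walks-meet a b walks x y bx≤ax ay≤by with ≤-total (toℕ x) (toℕ y)
... | inj₁ x≤y with alternating-walks-meet-ordered b a (AlternatingWalks-sym walks) x y x≤y bx≤ax ay≤by
...   | t , eq = t , sym eq
alternating-walks-meet a b walks x y bx≤ax ay≤by
    | inj₂ y≤x = alternating-walks-meet-ordered a b walks y x y≤x ay≤by bx≤ax

layer : ∀ {n k} → Vertex n k → ℕ
layer = toℕ ∘ p₂

Adj⇒Near : ∀ {n k} .{{_ : NonZero n}} {u v : Vertex n k} → Adj n k u v → Near (layer u) (layer v)
Adj⇒Near (inj₁ (_ , inj₁ up))   = inj₂ (inj₁ up)
Adj⇒Near (inj₁ (_ , inj₂ down)) = inj₂ (inj₂ down)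
Adj⇒Near (inj₂ (same , _))      = inj₁ (cong toℕ (sym same))

lazyStep⇒Near : ∀ {n k} .{{_ : NonZero n}} {u v : Vertex n k} → Adj n k u v ⊎ u ≡ v →
  Near (layer u) (layer v)
lazyStep⇒Near (inj₁ adj)  = Adj⇒Near adj
lazyStep⇒Near (inj₂ refl) = inj₁ refl

opposite-layers-alternate : ∀ {n k l} .{{_ : NonZero n}} (F G : LazyTrack n k l) → Opposite F G →
  AlternatingWalks (layer ∘ LazyTrack.f F) (layer ∘ LazyTrack.f G)
opposite-layers-alternate F G opp i j c with LazyTrack.step F i j c
... | inj₁ adj  = inj₂ (cong layer (sym (proj₁ (opp i j c) adj)) , Adj⇒Near adj)
... | inj₂ stay = inj₁ (cong layer (sym stay) , lazyStep⇒Near (LazyTrack.step G i j c))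

lemma1 : (n k l : ℕ) → .{{_ : NonZero n}} → 3 ≤ n → 2 ≤ k →
    (F G : LazyTrack n k l) → Opposite F G →
    ∃ λ (i : Fin l) → p₂ (LazyTrack.f F i) ≡ p₂ (LazyTrack.f G i)
lemma1 (suc n) (suc k) l (s≤s _) (s≤s _) F G opp
  with alternating-walks-meet (layer ∘ F.f) (layer ∘ G.f) (opposite-layers-alternate F G opp)
         x y (below-top (G.f x) (visits-top F)) (below-top (F.f y) (visits-top G))
  where
  module F = LazyTrack F
  module G = LazyTrack G
  top : Vertex (suc n) (suc k)
  top = fzero , fromℕ k
  x y : Fin l
  x = proj₁ (F.surj top)
  y = proj₁ (G.surj top)
  visits-top : (H : LazyTrack (suc n) (suc k) l) → LazyTrack.f H (proj₁ (LazyTrack.surj H top)) ≡ top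
  visits-top H = proj₂ (LazyTrack.surj H top) refl
  below-top : ∀ {v} (w : Vertex (suc n) (suc k)) → v ≡ top → layer w ≤ layer v
  below-top w refl = subst (layer w ≤_) (sym (toℕ-fromℕ k)) (toℕ≤pred[n] (p₂ w))
... | t , same-layer = t , toℕ-injective same-layer
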